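{- Let $m\ge 1$ and let $M$ be an $m$-by-$2m$ disjoint matrix. Then there are pairwise incomparable strings $\sigma_0,\tau_0,\dots,\sigma_{m-1},\tau_{m-1}$ such that $\sigma_i$ and $\tau_i$ both belong to the row $M(i)$ for every $i<m$.
   Context: Strings are finite binary strings, ordered by the prefix relation $\preceq$; two strings are incomparable if neither is a prefix of the other. An $m$-by-$n$ matrix $M$ is an array of strings $\sigma_{i,j}\in 2^{<\omega}$, $i<m$, $j<n$; its $i$th row $M(i)$ is the tuple $\sigma_{i,0},\dots,\sigma_{i,n-1}$. The matrix is disjoint if for each $i<m$ the strings $\sigma_{i,0},\dots,\sigma_{i,n-1}$ are pairwise incomparable. -}

module Defs where

open import Data.Bool using (Bool)
open import Data.List using (List; []; _∷_)
open import Data.Nat using (ℕ; _*_)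
open import Data.Fin using (Fin)
open import Data.Sum using (_⊎_; inj₁; inj₂)
open import Relation.Binary.PropositionalEquality using (_≡_)
open import Relation.Nullary using (¬_)
open import Data.Product using (_×_)
import Data.Product

Str : Set
Str = List Bool

data _⪯_ : Str → Str → Set where
  []⪯  : ∀ {τ} → [] ⪯ τ
  ∷⪯   : ∀ {b σ τ} → σ ⪯ τ → (b ∷ σ) ⪯ (b ∷ τ)

Incomparable : Str → Str → Set
Incomparable σ τ = ¬ (σ ⪯ τ) × ¬ (τ ⪯ σ)

Matrix : ℕ → ℕ → Set
Matrix m n = Fin m → Fin n → Str

Disjoint : ∀ {m n} → Matrix m n → Set
Disjoint {m} {n} M = ∀ (i : Fin m) (j k : Fin n) → ¬ (j ≡ k) → Incomparable (M i j) (M i k)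

InRow : ∀ {m n} → Matrix m n → Fin m → Str → Set
InRow {m} {n} M i σ = Data.Product.∃ λ (j : Fin n) → σ ≡ M i j

pick : ∀ {m} → (Fin m → Str) → (Fin m → Str) → Fin m ⊎ Fin m → Str
pick σ τ (inj₁ i) = σ i
pick σ τ (inj₂ i) = τ i

-- Treat the matrix as 2m slots, two per row, each offered the 2m entries of its row.
-- Greedily give a longest string σ among all offered entries to its slot. An entry of
-- another slot comparable with σ is no longer than σ, hence a prefix of σ; prefixes of σ
-- are pairwise comparable, so each antichain of offers loses at most one entry when these
-- are discarded. With n slots each offered at least n pairwise incomparable strings,
-- induction on n then yields pairwise incomparable choices.

module Submission where

open import Defs
import Data.Bool.Properties as Bool
open import Data.Empty using (⊥-elim)
open import Data.Fin as Fin using (Fin; _≟_; punchIn; punchOut; splitAt; join)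
open import Data.Fin.Properties using (punchIn-punchOut; punchOut-injective; splitAt-join)
open import Data.List using (List; []; _∷_; length; filter; tabulate; concat)
open import Data.List.Extrema.Nat using (argmax; argmax-sel; f[xs]≤f[argmax])
open import Data.List.Membership.Propositional using (_∈_)
open import Data.List.Membership.Propositional.Properties
  using (∈-filter⁻; ∈-tabulate⁺; ∈-tabulate⁻; ∈-concat⁺′; ∈-concat⁻)
open import Data.List.Properties using (filter-accept; filter-reject; filter-all; length-tabulate)
open import Data.List.Relation.Unary.All as All using (All; []; _∷_)
open import Data.List.Relation.Unary.Any using (here)
open import Data.List.Relation.Unary.AllPairs using (AllPairs; []; _∷_)
import Data.List.Relation.Unary.AllPairs.Properties as AllPairs
import Data.List.Relation.Unary.Any.Properties as Any
open import Data.Nat using (ℕ; zero; suc; _*_; _+_; _≥_; _≤_; z≤n; s≤s; s≤s⁻¹)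
open import Data.Nat.Properties using (≤-refl; ≤-trans; ≤-reflexive; +-identityʳ)
open import Data.Product using (Σ; ∃₂; _×_; _,_; proj₁; proj₂; swap; uncurry)
open import Data.Sum using (_⊎_; inj₁; inj₂; [_,_]′)
open import Function using (id; _∘_)
open import Relation.Binary.Definitions using (Decidable)
open import Relation.Binary.PropositionalEquality
  using (_≡_; _≢_; refl; sym; trans; cong; subst; subst₂)
open import Relation.Nullary using (¬_; yes; no)
open import Relation.Nullary.Decidable using (¬?; _×-dec_)

_⪯?_ : Decidable _⪯_
[] ⪯? τ = yes []⪯
(b ∷ σ) ⪯? [] = no λ ()
(b ∷ σ) ⪯? (c ∷ τ) with b Bool.≟ c | σ ⪯? τ
... | yes refl | yes σ⪯τ = yes (∷⪯ σ⪯τ)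
... | yes refl | no σ⋠τ = no λ { (∷⪯ σ⪯τ) → σ⋠τ σ⪯τ }
... | no b≢c   | _      = no λ { (∷⪯ _) → b≢c refl }

incomparable? : Decidable Incomparable
incomparable? σ τ = ¬? (σ ⪯? τ) ×-dec ¬? (τ ⪯? σ)

incomparable-sym : ∀ {σ τ} → Incomparable σ τ → Incomparable τ σ
incomparable-sym = swap

⪯-longer⇒⪯ : ∀ {σ τ} → σ ⪯ τ → length τ ≤ length σ → τ ⪯ σ
⪯-longer⇒⪯ {τ = []} []⪯      _         = []⪯
⪯-longer⇒⪯          (∷⪯ σ⪯τ) (s≤s τ≤σ) = ∷⪯ (⪯-longer⇒⪯ σ⪯τ τ≤σ)

prefixes-comparable : ∀ {ρ σ τ} → ρ ⪯ τ → σ ⪯ τ → ρ ⪯ σ ⊎ σ ⪯ ρ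
prefixes-comparable []⪯       _         = inj₁ []⪯
prefixes-comparable (∷⪯ _)    []⪯       = inj₂ []⪯
prefixes-comparable (∷⪯ ρ⪯τ) (∷⪯ σ⪯τ) with prefixes-comparable ρ⪯τ σ⪯τ
... | inj₁ ρ⪯σ = inj₁ (∷⪯ ρ⪯σ)
... | inj₂ σ⪯ρ = inj₂ (∷⪯ σ⪯ρ)

shorter-comparable⇒⪯ : ∀ {σ τ} → length τ ≤ length σ → ¬ Incomparable σ τ → τ ⪯ σ
shorter-comparable⇒⪯ {σ} {τ} τ≤σ σ∦τ with τ ⪯? σ | σ ⪯? τ
... | yes τ⪯σ | _       = τ⪯σ
... | no _    | yes σ⪯τ = ⪯-longer⇒⪯ σ⪯τ τ≤σ
... | no τ⋠σ  | no σ⋠τ  = ⊥-elim (σ∦τ (σ⋠τ , τ⋠σ))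

incomparable-to-extension : ∀ {ρ σ τ} → ρ ⪯ σ → length τ ≤ length σ →
  Incomparable ρ τ → Incomparable σ τ
incomparable-to-extension {σ = σ} {τ} ρ⪯σ τ≤σ ρ#τ with incomparable? σ τ
... | yes σ#τ = σ#τ
... | no σ∦τ  =
  ⊥-elim ([ proj₁ ρ#τ , proj₂ ρ#τ ]′ (prefixes-comparable ρ⪯σ (shorter-comparable⇒⪯ τ≤σ σ∦τ)))

length≤suc-filter-incomparable : ∀ {σ} {xs : List Str} → AllPairs Incomparable xs →
  All (λ x → length x ≤ length σ) xs →
  length xs ≤ suc (length (filter (incomparable? σ) xs))
length≤suc-filter-incomparable [] [] = z≤n
length≤suc-filter-incomparable {σ} {x ∷ xs} (x#xs ∷ xs#) (x≤σ ∷ xs≤σ) with incomparable? σ x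
... | yes σ#x
  rewrite filter-accept (incomparable? σ) {x} {xs} σ#x =
    s≤s (length≤suc-filter-incomparable xs# xs≤σ)
... | no σ∦x
  rewrite filter-reject (incomparable? σ) {x} {xs} σ∦x
        | filter-all (incomparable? σ) {xs}
            (All.zipWith (uncurry (incomparable-to-extension (shorter-comparable⇒⪯ x≤σ σ∦x)))
              (xs≤σ , x#xs)) = s≤s ≤-refl

longestEntry : ∀ {n} (L : Fin n → List Str) {p x} → x ∈ L p →
  ∃₂ λ q σ → σ ∈ L q × (∀ r → All (λ y → length y ≤ length σ) (L r))
longestEntry {n} L {p} {x} x∈Lp = slot , σ , σ∈L-slot , longest
  where
  entries : List Str
  entries = concat (tabulate L)

  entry : ∀ {q y} → y ∈ L q → y ∈ entries
  entry {q} y∈Lq = ∈-concat⁺′ y∈Lq (∈-tabulate⁺ q)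

  σ : Str
  σ = argmax length x entries

  σ∈entries : σ ∈ entries
  σ∈entries = [ (λ σ≡x → subst (_∈ entries) (sym σ≡x) (entry x∈Lp)) , id ]′
                (argmax-sel length x entries)

  slot : Fin n
  slot = proj₁ (Any.tabulate⁻ (∈-concat⁻ (tabulate L) σ∈entries))

  σ∈L-slot : σ ∈ L slot
  σ∈L-slot = proj₂ (Any.tabulate⁻ (∈-concat⁻ (tabulate L) σ∈entries))

  longest : ∀ r → All (λ y → length y ≤ length σ) (L r)
  longest r = All.tabulate (All.lookup (f[xs]≤f[argmax] x entries) ∘ entry)

nonempty⇒∈ : ∀ {n} {xs : List Str} → suc n ≤ length xs → Σ Str (_∈ xs)
nonempty⇒∈ {xs = x ∷ _} _ = x , here refl

IncomparableTransversal : ∀ {n} → (Fin n → List Str) → Set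
IncomparableTransversal {n} L = Σ (Fin n → Str) λ f →
  (∀ q → f q ∈ L q) × (∀ q r → q ≢ r → Incomparable (f q) (f r))

incomparableTransversal : ∀ n (L : Fin n → List Str) →
  (∀ q → AllPairs Incomparable (L q)) → (∀ q → n ≤ length (L q)) →
  IncomparableTransversal L
incomparableTransversal zero    L _  _    = (λ ()) , (λ ()) , (λ ())
incomparableTransversal (suc n) L L# long
  with longestEntry L (proj₂ (nonempty⇒∈ (long Fin.zero)))
... | p , σ , σ∈Lp , σ-longest = extend (incomparableTransversal n L′ L′# long′)
  where
  L′ : Fin n → List Str
  L′ q = filter (incomparable? σ) (L (punchIn p q))

  L′# : ∀ q → AllPairs Incomparable (L′ q)
  L′# q = AllPairs.filter⁺ (incomparable? σ) (L# (punchIn p q))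

  long′ : ∀ q → n ≤ length (L′ q)
  long′ q = s≤s⁻¹ (≤-trans (long (punchIn p q))
              (length≤suc-filter-incomparable (L# (punchIn p q)) (σ-longest (punchIn p q))))

  extend : IncomparableTransversal L′ → IncomparableTransversal L
  extend (g , g∈L′ , g#) = f , f∈L , f#
    where
    f : Fin (suc n) → Str
    f q with p ≟ q
    ... | yes _   = σ
    ... | no p≢q = g (punchOut p≢q)

    f∈L : ∀ q → f q ∈ L q
    f∈L q with p ≟ q
    ... | yes refl = σ∈Lp
    ... | no p≢q   = subst (λ r → g (punchOut p≢q) ∈ L r) (punchIn-punchOut p≢q)
                       (proj₁ (∈-filter⁻ (incomparable? σ) (g∈L′ (punchOut p≢q))))

    σ#g : ∀ q → Incomparable σ (g q)
    σ#g q = proj₂ (∈-filter⁻ (incomparable? σ) {xs = L (punchIn p q)} (g∈L′ q))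

    f# : ∀ q r → q ≢ r → Incomparable (f q) (f r)
    f# q r q≢r with p ≟ q | p ≟ r
    ... | yes refl | yes refl = ⊥-elim (q≢r refl)
    ... | yes refl | no p≢r   = σ#g (punchOut p≢r)
    ... | no p≢q   | yes refl = incomparable-sym (σ#g (punchOut p≢q))
    ... | no p≢q   | no p≢r   = g# _ _ (q≢r ∘ punchOut-injective p≢q p≢r)

join-injective : ∀ m n {p q : Fin m ⊎ Fin n} → join m n p ≡ join m n q → p ≡ q
join-injective m n {p} {q} e =
  trans (sym (splitAt-join m n p)) (trans (cong (splitAt m) e) (splitAt-join m n q))

pick-∘-inj : ∀ {m} (h : Fin m ⊎ Fin m → Str) p → pick (h ∘ inj₁) (h ∘ inj₂) p ≡ h p
pick-∘-inj h (inj₁ i) = refl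
pick-∘-inj h (inj₂ i) = refl

lemma3p2 : (m : ℕ) → m ≥ 1 → (M : Matrix m (2 * m)) → Disjoint M →
    Σ (Fin m → Str) λ σ → Σ (Fin m → Str) λ τ →
      ((i : Fin m) → InRow M i (σ i) × InRow M i (τ i)) ×
      ((p q : Fin m ⊎ Fin m) → ¬ (p ≡ q) → Incomparable (pick σ τ p) (pick σ τ q))
lemma3p2 m _ M disjoint =
  h ∘ inj₁ , h ∘ inj₂ , (λ i → h∈row (inj₁ i) , h∈row (inj₂ i)) ,
  λ p q p≢q → subst₂ Incomparable (sym (pick-∘-inj h p)) (sym (pick-∘-inj h q))
                (h# p q p≢q)
  where
  row : Fin m ⊎ Fin m → Fin m
  row = [ id , id ]′

  rows : Fin (m + m) → List Str
  rows k = tabulate (M (row (splitAt m k)))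

  rows# : ∀ k → AllPairs Incomparable (rows k)
  rows# k = AllPairs.tabulate⁺ (disjoint (row (splitAt m k)) _ _)

  long : ∀ k → m + m ≤ length (rows k)
  long k = ≤-reflexive (sym (trans (length-tabulate (M (row (splitAt m k))))
                                   (cong (m +_) (+-identityʳ m))))

  transversal : IncomparableTransversal rows
  transversal = incomparableTransversal (m + m) rows rows# long

  h : Fin m ⊎ Fin m → Str
  h = proj₁ transversal ∘ join m m

  h∈row : ∀ p → InRow M (row p) (h p)
  h∈row p = subst (λ i → InRow M i (h p)) (cong row (splitAt-join m m p))
              (∈-tabulate⁻ (proj₁ (proj₂ transversal) (join m m p)))

  h# : ∀ p q → p ≢ q → Incomparable (h p) (h q)
  h# p q p≢q = proj₂ (proj₂ transversal) (join m m p) (join m m q) (p≢q ∘ join-injective m m)
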